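{- A proper linear game $v$ on $n$ voters has rank $2^{n-1}$ (the minimal rank among proper linear games on $n$ voters) if and only if $v$ is self-dual.
   Context: Let $N=\{1,\dots,n\}$. A simple game is a family $W$ of subsets of $N$ (winning coalitions) with $N\in W$, $\emptyset\notin W$, closed under supersets. Order subsets of $N$ by: for $A=\{a_1>\dots>a_k\}$, $B=\{b_1>\dots>b_j\}$, $B\ge A$ iff $k\le j$ and $b_i\ge a_i$ for $i\le k$. A linear game is a simple game whose winning set is an up-set for this order; its rank is its number of losing coalitions. A game is proper if for each coalition $A$ at most one of $A$, $N\setminus A$ is winning, and self-dual if for each coalition $A$ exactly one of $A$, $N\setminus A$ is winning. -}

module Defs where

open import Data.Bool using (Bool; true; false; not)
open import Data.Nat using (ℕ; zero; suc; _≤_)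
open import Data.List using (List; []; _∷_; _++_; map; filter; length)
open import Data.Vec using ([]; _∷_)
open import Data.Fin.Subset using (Subset; _⊆_; ∁) renaming (⊤ to Full; ⊥ to Empty)
open import Data.Unit using (⊤)
open import Data.Empty using (⊥)
open import Data.Product using (_×_)
open import Relation.Binary.PropositionalEquality using (_≡_)
open import Relation.Nullary.Decidable using (¬?)
open import Data.Bool.Properties using (T?)
open import Data.Bool using (T)

-- Voters N = {1,…,n} are represented by Fin n (position i ↦ voter i+1);
-- coalitions are Data.Fin.Subset (Vec Bool n).

-- Elements of a coalition listed in DECREASING order (as numbers 0..n-1).
elemsDesc : ∀ {n} → Subset n → List ℕ
elemsDesc [] = []
elemsDesc (b ∷ v) = map suc (elemsDesc v) ++ tail b
  where
  tail : Bool → List ℕ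
  tail true  = 0 ∷ []
  tail false = []

Dom : List ℕ → List ℕ → Set
Dom []       _        = ⊤
Dom (a ∷ as) []       = ⊥
Dom (a ∷ as) (b ∷ bs) = (a ≤ b) × Dom as bs

_≽_ : ∀ {n} → Subset n → Subset n → Set
B ≽ A = Dom (elemsDesc A) (elemsDesc B)

allSubsets : (n : ℕ) → List (Subset n)
allSubsets zero = [] ∷ []
allSubsets (suc n) = map (true ∷_) (allSubsets n) ++ map (false ∷_) (allSubsets n)

record SimpleGame (n : ℕ) : Set where
  field
    W        : Subset n → Bool
    full-win : W Full ≡ true
    empty-lose : W Empty ≡ false
    monotone : ∀ A B → A ⊆ B → W A ≡ true → W B ≡ true
open SimpleGame public

IsLinear : ∀ {n} → SimpleGame n → Set
IsLinear {n} v = ∀ (A B : Subset n) → B ≽ A → W v A ≡ true → W v B ≡ true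

rank : ∀ {n} → SimpleGame n → ℕ
rank {n} v = length (filter (λ A → ¬? (T? (W v A))) (allSubsets n))

IsProper : ∀ {n} → SimpleGame n → Set
IsProper {n} v = ∀ (A : Subset n) → W v A ≡ true → W v (∁ A) ≡ false

IsSelfDual : ∀ {n} → SimpleGame n → Set
IsSelfDual {n} v = ∀ (A : Subset n) → W v (∁ A) ≡ not (W v A)

-- A coalition and its complement can't both win in a proper game, so each of the
-- 2ⁿ pairs (A, N∖A) contributes at least one losing coalition to the double count
-- Σ_A [A loses] + [N∖A loses] = 2 · rank; equality 2 · rank = 2ⁿ holds exactly
-- when every pair contributes exactly one, i.e. when the game is self-dual.
module Submission where

open import Defs
open import Data.Bool using (Bool; true; false; not)
open import Data.Bool.Properties using (T?)
open import Data.Empty using (⊥-elim)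
open import Data.Fin.Subset using (Subset; ∁)
open import Data.List using (List; []; _∷_; _++_; map; filter; length; reverse)
open import Data.List.Membership.Propositional using (_∈_)
open import Data.List.Membership.Propositional.Properties using (∈-++⁺ˡ; ∈-++⁺ʳ; ∈-map⁺)
open import Data.List.Properties using (length-++; length-map; map-++; map-∘; reverse-map; reverse-++)
open import Data.List.Relation.Binary.Permutation.Propositional using (_↭_)
open import Data.List.Relation.Binary.Permutation.Propositional.Properties using (↭-reverse; map⁺)
open import Data.List.Relation.Unary.All as All using (All; []; _∷_)
open import Data.List.Relation.Unary.Any using (here)
open import Data.Nat using (ℕ; zero; suc; _^_; _∸_; _+_; _*_; _≤_; z≤n; s≤s)
open import Data.Nat.ListAction using (sum)
open import Data.Nat.ListAction.Properties using (sum-↭)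
open import Data.Nat.Properties
  using (+-identityʳ; +-mono-≤; +-monoʳ-≤; +-cancelʳ-≤; +-cancelˡ-≡; ≤-antisym; ≤-trans; ≤-reflexive; *-cancelˡ-≡; +-commutativeSemigroup)
open import Data.Vec using ([]; _∷_)
open import Function using (_∘_)
open import Function.Bundles using (_⇔_; mk⇔; Equivalence)
open import Function.Properties.Equivalence using () renaming (trans to ⇔-trans; sym to ⇔-sym)
open import Relation.Binary.PropositionalEquality using (_≡_; refl; sym; trans; cong; cong₂; subst; subst₂; module ≡-Reasoning)
open import Relation.Nullary using (¬_)
open import Relation.Nullary.Decidable using (¬?)
open import Algebra.Properties.CommutativeSemigroup +-commutativeSemigroup using (interchange)

lossCount : Bool → ℕ
lossCount true  = 0
lossCount false = 1

lossCount-+≡1⇔not : ∀ a b → (lossCount a + lossCount b ≡ 1 ⇔ b ≡ not a)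
lossCount-+≡1⇔not true  true  = mk⇔ (λ ()) (λ ())
lossCount-+≡1⇔not true  false = mk⇔ (λ _ → refl) (λ _ → refl)
lossCount-+≡1⇔not false true  = mk⇔ (λ _ → refl) (λ _ → refl)
lossCount-+≡1⇔not false false = mk⇔ (λ ()) (λ ())

1≤lossCount-+ : ∀ a b → (a ≡ true → b ≡ false) → 1 ≤ lossCount a + lossCount b
1≤lossCount-+ true  true  a⇒¬b with a⇒¬b refl
... | ()
1≤lossCount-+ true  false _ = s≤s z≤n
1≤lossCount-+ false _     _ = s≤s z≤n

module _ {a} {A : Set a} where

  length-filter-¬T : (p : A → Bool) (xs : List A) →
                     length (filter (λ x → ¬? (T? (p x))) xs) ≡ sum (map (lossCount ∘ p) xs)
  length-filter-¬T p []       = refl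
  length-filter-¬T p (x ∷ xs) with p x
  ... | true  = length-filter-¬T p xs
  ... | false = cong suc (length-filter-¬T p xs)

  sum-map-+ : (f g : A → ℕ) (xs : List A) →
              sum (map (λ x → f x + g x) xs) ≡ sum (map f xs) + sum (map g xs)
  sum-map-+ f g []       = refl
  sum-map-+ f g (x ∷ xs) = trans (cong (f x + g x +_) (sum-map-+ f g xs))
                                 (interchange (f x) (g x) (sum (map f xs)) (sum (map g xs)))

  module _ (f : A → ℕ) (1≤f : ∀ x → 1 ≤ f x) where

    length≤sum-map : (xs : List A) → length xs ≤ sum (map f xs)
    length≤sum-map []       = z≤n
    length≤sum-map (x ∷ xs) = +-mono-≤ (1≤f x) (length≤sum-map xs)

    sum-map≡length⇔All≡1 : (xs : List A) → (sum (map f xs) ≡ length xs ⇔ All (λ x → f x ≡ 1) xs)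
    sum-map≡length⇔All≡1 xs = mk⇔ (to xs) (from xs)
      where
      to : ∀ xs → sum (map f xs) ≡ length xs → All (λ x → f x ≡ 1) xs
      to []       _ = []
      to (x ∷ xs) eq = fx≡1 ∷ to xs (+-cancelˡ-≡ 1 _ _ (trans (cong (_+ sum (map f xs)) (sym fx≡1)) eq))
        where
        -- f x + length xs ≤ f x + Σ f xs = 1 + length xs
        fx≡1 : f x ≡ 1
        fx≡1 = ≤-antisym (+-cancelʳ-≤ (length xs) (f x) 1
                            (≤-trans (+-monoʳ-≤ (f x) (length≤sum-map xs)) (≤-reflexive eq)))
                         (1≤f x)
      from : ∀ xs → All (λ x → f x ≡ 1) xs → sum (map f xs) ≡ length xs
      from []       []           = refl
      from (x ∷ xs) (fx≡1 ∷ all) = cong₂ _+_ fx≡1 (from xs all)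

length-allSubsets : ∀ n → length (allSubsets n) ≡ 2 ^ n
length-allSubsets zero    = refl
length-allSubsets (suc n) = begin
  length (map (true ∷_) S ++ map (false ∷_) S)    ≡⟨ length-++ (map (true ∷_) S) ⟩
  length (map (true ∷_) S) + length (map (false ∷_) S)
    ≡⟨ cong₂ _+_ (length-map (true ∷_) S) (length-map (false ∷_) S) ⟩
  length S + length S                              ≡⟨ cong₂ _+_ (length-allSubsets n) (length-allSubsets n) ⟩
  2 ^ n + 2 ^ n                                    ≡⟨ cong (2 ^ n +_) (sym (+-identityʳ (2 ^ n))) ⟩
  2 ^ suc n                                        ∎
  where
  open ≡-Reasoning
  S = allSubsets n

∈-allSubsets : ∀ {n} (A : Subset n) → A ∈ allSubsets n
∈-allSubsets []          = here refl
∈-allSubsets (true ∷ A)  = ∈-++⁺ˡ (∈-map⁺ (true ∷_) (∈-allSubsets A))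
∈-allSubsets (false ∷ A) = ∈-++⁺ʳ (map (true ∷_) (allSubsets _)) (∈-map⁺ (false ∷_) (∈-allSubsets A))

map-∁-allSubsets : ∀ n → map ∁ (allSubsets n) ≡ reverse (allSubsets n)
map-∁-allSubsets zero    = refl
map-∁-allSubsets (suc n) = begin
  map ∁ (map (true ∷_) S ++ map (false ∷_) S)            ≡⟨ map-++ ∁ (map (true ∷_) S) (map (false ∷_) S) ⟩
  map ∁ (map (true ∷_) S) ++ map ∁ (map (false ∷_) S)    ≡⟨ cong₂ _++_ (∁-after-cons true) (∁-after-cons false) ⟩
  map (false ∷_) (map ∁ S) ++ map (true ∷_) (map ∁ S)
    ≡⟨ cong₂ (λ xs ys → map (false ∷_) xs ++ map (true ∷_) ys) (map-∁-allSubsets n) (map-∁-allSubsets n) ⟩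
  map (false ∷_) (reverse S) ++ map (true ∷_) (reverse S) ≡⟨ cong₂ _++_ (reverse-map (false ∷_) S) (reverse-map (true ∷_) S) ⟩
  reverse (map (false ∷_) S) ++ reverse (map (true ∷_) S) ≡⟨ sym (reverse-++ (map (true ∷_) S) (map (false ∷_) S)) ⟩
  reverse (map (true ∷_) S ++ map (false ∷_) S)          ∎
  where
  open ≡-Reasoning
  S = allSubsets n
  ∁-after-cons : ∀ b → map ∁ (map (b ∷_) S) ≡ map (not b ∷_) (map ∁ S)
  ∁-after-cons b = trans (sym (map-∘ S)) (map-∘ S)

sum-map-∘∁ : ∀ n (f : Subset n → ℕ) → sum (map (f ∘ ∁) (allSubsets n)) ≡ sum (map f (allSubsets n))
sum-map-∘∁ n f = trans (cong sum (map-∘ (allSubsets n))) (sum-↭ (map⁺ f ∁-permutes))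
  where
  ∁-permutes : map ∁ (allSubsets n) ↭ allSubsets n
  ∁-permutes = subst (_↭ allSubsets n) (sym (map-∁-allSubsets n)) (↭-reverse (allSubsets n))

¬SimpleGame-0 : ¬ SimpleGame 0
¬SimpleGame-0 v with trans (sym (full-win v)) (empty-lose v)
... | ()

module _ {n} (v : SimpleGame n) where

  pairLoss : Subset n → ℕ
  pairLoss A = lossCount (W v A) + lossCount (W v (∁ A))

  2*rank≡sum-pairLoss : 2 * rank v ≡ sum (map pairLoss (allSubsets n))
  2*rank≡sum-pairLoss = begin
    2 * rank v                               ≡⟨ cong (rank v +_) (+-identityʳ (rank v)) ⟩
    rank v + rank v                          ≡⟨ cong₂ _+_ rank≡ (trans rank≡ (sym (sum-map-∘∁ n (lossCount ∘ W v)))) ⟩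
    sum (map (lossCount ∘ W v) S) + sum (map (lossCount ∘ W v ∘ ∁) S)
                                             ≡⟨ sym (sum-map-+ (lossCount ∘ W v) (lossCount ∘ W v ∘ ∁) S) ⟩
    sum (map pairLoss S)                     ∎
    where
    open ≡-Reasoning
    S = allSubsets n
    rank≡ : rank v ≡ sum (map (lossCount ∘ W v) S)
    rank≡ = length-filter-¬T (W v) S

  isSelfDual⇔All-pairLoss≡1 : IsSelfDual v ⇔ All (λ A → pairLoss A ≡ 1) (allSubsets n)
  isSelfDual⇔All-pairLoss≡1 = mk⇔
    (λ selfDual → All.tabulate λ {A} _ → from (pair⇔ A) (selfDual A))
    (λ all A → to (pair⇔ A) (All.lookup all (∈-allSubsets A)))
    where
    open Equivalence
    pair⇔ : ∀ A → (pairLoss A ≡ 1 ⇔ W v (∁ A) ≡ not (W v A))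
    pair⇔ A = lossCount-+≡1⇔not (W v A) (W v (∁ A))

  2*rank≡2^n⇔isSelfDual : IsProper v → (2 * rank v ≡ 2 ^ n ⇔ IsSelfDual v)
  2*rank≡2^n⇔isSelfDual proper =
    ⇔-trans (subst₂ (λ l r → l ≡ r ⇔ All (λ A → pairLoss A ≡ 1) (allSubsets n))
                    (sym 2*rank≡sum-pairLoss) (length-allSubsets n)
                    (sum-map≡length⇔All≡1 pairLoss 1≤pairLoss (allSubsets n)))
            (⇔-sym isSelfDual⇔All-pairLoss≡1)
    where
    1≤pairLoss : ∀ A → 1 ≤ pairLoss A
    1≤pairLoss A = 1≤lossCount-+ (W v A) (W v (∁ A)) (proper A)

halve-≡-2^ : ∀ r m → (r ≡ 2 ^ m ⇔ 2 * r ≡ 2 ^ suc m)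
halve-≡-2^ r m = mk⇔ (cong (2 *_)) (*-cancelˡ-≡ r (2 ^ m) 2)

corollary3p11 : (n : ℕ) (v : SimpleGame n) → IsLinear v → IsProper v →
                  (rank v ≡ 2 ^ (n ∸ 1) ⇔ IsSelfDual v)
corollary3p11 zero    v _ _      = ⊥-elim (¬SimpleGame-0 v)
corollary3p11 (suc m) v _ proper = ⇔-trans (halve-≡-2^ (rank v) m) (2*rank≡2^n⇔isSelfDual v proper)
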